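{- There exists a probabilistic context-free grammar $\mathcal{G}$ such that, for the Hankel matrix $H_{\mathcal{G}}$ of its skeletal tree series, no finite set of rows of $H_{\mathcal{G}}$ positively spans the entire matrix (i.e. there is no finite set $F$ of rows such that every row of $H_{\mathcal{G}}$ is a linear combination with nonnegative coefficients of rows in $F$).
   Context: A PCFG is a context-free grammar $(\mathcal{V},\Sigma,R,S)$ with weights $\theta:R\to[0,1]$ such that for every variable $V$ the weights of the rules with left-hand side $V$ sum to $1$; the weight of a derivation tree is the product of the weights of its rules. Skeletal trees are trees whose internal nodes are labelled by a symbol ? (of the appropriate arity) and whose leaves are terminals; the skeleton of a derivation tree replaces every variable label by ?. The skeletal tree series of $\mathcal{G}$ assigns to each skeletal tree $s$ the sum of weights of derivation trees rooted at $S$ with skeleton $s$. A context is a skeletal tree with one leaf replaced by a hole $\diamond$, and $c[t]$ denotes the tree obtained by plugging $t$ into the hole. The Hankel matrix $H_{\mathcal{G}}$ has rows indexed by skeletal trees $t$, columns indexed by contexts $c$, and entry equal to the value of the skeletal tree series at $c[t]$.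
   Formalization: The rule weights θ of the grammar and the nonnegative coefficients of the positive combinations of rows are taken in the rationals. -}

module Defs where

open import Data.Nat using (ℕ; zero; suc)
open import Data.Fin using (Fin; zero; suc)
open import Data.Fin.Properties using () renaming (_≟_ to _≟F_)
open import Data.List using (List; []; _∷_; map)
open import Data.List.Relation.Unary.All using (All)
open import Data.List.Relation.Unary.Unique.Propositional using (Unique)
open import Data.Product using (_×_; _,_; proj₁; proj₂)
open import Data.Sum using (_⊎_; inj₁; inj₂)
open import Data.Rational using (ℚ; 0ℚ; 1ℚ; _+_; _*_; _≤_)
open import Relation.Nullary using (yes; no)
open import Relation.Binary.PropositionalEquality using (_≡_)

-- Symbols of a grammar with n variables and k terminals:
-- inj₁ V is the variable V, inj₂ a is the terminal a.
Sym : ℕ → ℕ → Set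
Sym n k = Fin n ⊎ Fin k

RHS : ℕ → ℕ → Set
RHS n k = List (Sym n k)

sumℚ : List ℚ → ℚ
sumℚ []       = 0ℚ
sumℚ (x ∷ xs) = x + sumℚ xs

-- For each variable V, (rules V) lists the rules V → α together with their
-- weights θ(V → α); the right-hand sides are pairwise distinct (a set of rules).
record PCFG (k : ℕ) : Set where
  field
    n        : ℕ
    start    : Fin n
    rules    : Fin n → List (RHS n k × ℚ)
    distinct : ∀ V → Unique (map proj₁ (rules V))
    nonneg   : ∀ V → All (λ r → 0ℚ ≤ proj₂ r) (rules V)
    le-one   : ∀ V → All (λ r → proj₂ r ≤ 1ℚ) (rules V)
    sum-one  : ∀ V → sumℚ (map proj₂ (rules V)) ≡ 1ℚ

-- Skeletal trees: internal nodes labelled ? (arity = number of children),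
-- leaves labelled by terminals.
data Skel (k : ℕ) : Set where
  leaf : Fin k → Skel k
  node : List (Skel k) → Skel k

data Ctx (k : ℕ) : Set where
  hole : Ctx k
  node : List (Skel k) → Ctx k → List (Skel k) → Ctx k

_⟦_⟧ : ∀ {k} → Ctx k → Skel k → Skel k
hole ⟦ t ⟧           = t
node l c r ⟦ t ⟧     = node (Data.List._++_ l (c ⟦ t ⟧ ∷ r))

-- Inside weights: wt G t V = sum of the weights of all derivation trees with
-- root variable V and skeleton t.  Computed by the standard recursion:
-- a derivation tree with root V and skeleton node ts consists of a rule
-- V → X₁…X_m (m = length ts) and, for each i, a derivation tree with root X_i
-- and skeleton t_i (if X_i is a terminal a, t_i must be the leaf a).
module _ {k : ℕ} (G : PCFG k) where
  open PCFG G

  mutual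
    wt : Skel k → Fin n → ℚ
    wt (leaf _)  V = 0ℚ
    wt (node ts) V = sumRules (rules V) ts

    sumRules : List (RHS n k × ℚ) → List (Skel k) → ℚ
    sumRules []              ts = 0ℚ
    sumRules ((α , w) ∷ rs)  ts = w * matchL α ts + sumRules rs ts

    matchL : RHS n k → List (Skel k) → ℚ
    matchL []             []              = 1ℚ
    matchL (inj₁ V ∷ α)   (t ∷ ts)        = wt t V * matchL α ts
    matchL (inj₂ a ∷ α)   (leaf b ∷ ts) with a ≟F b
    ... | yes _ = matchL α ts
    ... | no  _ = 0ℚ
    matchL (inj₂ a ∷ α)   (node _ ∷ ts)   = 0ℚ
    matchL []             (_ ∷ _)         = 0ℚ
    matchL (_ ∷ _)        []              = 0ℚ

  series : Skel k → ℚ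
  series t = wt t start

  hankel : Skel k → Ctx k → ℚ
  hankel t c = series (c ⟦ t ⟧)

Σfin : (m : ℕ) → (Fin m → ℚ) → ℚ
Σfin zero    f = 0ℚ
Σfin (suc m) f = f zero + Σfin m (λ i → f (suc i))

PositivelySpans : ∀ {k} (G : PCFG k) (m : ℕ) → (Fin m → Skel k) → Set
PositivelySpans {k} G m F =
  (t : Skel k) → Data.Product.Σ (Fin m → ℚ) λ λs →
    ((i : Fin m) → 0ℚ ≤ λs i) ×
    ((c : Ctx k) → hankel G t c ≡ Σfin m (λ i → λs i * hankel G (F i) c))

-- Take S → A a | B with weight ½ each, A → A (¼) | a (¾) and B → B (½) | a (½).
-- The contexts ?(◇, a) and ?(◇) can only be derived through S → A a and S → B
-- respectively, so on row s these two columns hold ½·wA(s) and ½·wB(s).  Every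
-- skeleton s satisfies wB(s) ≤ 2^d(s)·wA(s), d the length of its leftmost branch,
-- and a bound "column ?(◇) ≤ K · column ?(◇, a)" passes from finitely many rows to
-- all their nonnegative combinations.  So finitely many rows of maximal depth D could
-- only span rows with wB ≤ 2^D·wA, yet along a unary chain wB/wA grows like 2^d.
module Submission where

open import Defs
open import Data.Nat using (ℕ; zero; suc; _⊔_; _≤′_; ≤′-refl; ≤′-step)
  renaming (_≤_ to _≤ℕ_)
open import Data.Nat.Properties using (m≤m⊔n; m≤n⊔m; ≤⇒≤′)
  renaming (≤-trans to ≤ℕ-trans)
open import Data.Fin using (Fin; zero; suc)
open import Data.Fin.Properties using () renaming (_≟_ to _≟F_)
open import Data.List using (List; []; _∷_)
open import Data.List.Relation.Unary.All using (All; []; _∷_; all?)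
open import Data.List.Relation.Unary.AllPairs using ([]; _∷_)
open import Data.Product using (Σ; ∃; _×_; _,_; proj₂)
open import Data.Sum using (inj₁; inj₂)
open import Data.Rational using (ℚ; 0ℚ; 1ℚ; ½; _+_; _*_; _/_; _≤_; _<_; _≤?_; _<?_; nonNegative)
open import Data.Integer using (+_)
open import Data.Rational.Properties
  using (≤-refl; ≤-reflexive; ≤-trans; <-≤-trans; <-irrefl; +-mono-≤; +-identityʳ; *-zeroʳ;
         *-monoˡ-≤-nonNeg; *-monoʳ-≤-nonNeg; *-monoʳ-<-pos;
         nonNegative⁻¹; nonNeg*nonNeg⇒nonNeg; nonNeg+nonNeg⇒nonNeg; module ≤-Reasoning)
open import Data.Rational.Solver using (module +-*-Solver)
open import Relation.Nullary using (¬_; yes; no)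
open import Relation.Nullary.Decidable using (from-yes)
open import Relation.Binary.PropositionalEquality using (_≡_; refl; sym; cong; subst₂)

open +-*-Solver

0≤p*q : ∀ {p q} → 0ℚ ≤ p → 0ℚ ≤ q → 0ℚ ≤ p * q
0≤p*q {p} {q} 0≤p 0≤q =
  nonNegative⁻¹ _ {{nonNeg*nonNeg⇒nonNeg p {{nonNegative 0≤p}} q {{nonNegative 0≤q}}}}

0≤p+q : ∀ {p q} → 0ℚ ≤ p → 0ℚ ≤ q → 0ℚ ≤ p + q
0≤p+q {p} {q} 0≤p 0≤q =
  nonNegative⁻¹ _ {{nonNeg+nonNeg⇒nonNeg p {{nonNegative 0≤p}} q {{nonNegative 0≤q}}}}

module _ {k : ℕ} (G : PCFG k) where
  open PCFG G

  mutual
    wt-nonNeg : ∀ t V → 0ℚ ≤ wt G t V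
    wt-nonNeg (leaf _)  V = ≤-refl
    wt-nonNeg (node ts) V = sumRules-nonNeg (rules V) (nonneg V) ts

    sumRules-nonNeg : ∀ rs → All (λ r → 0ℚ ≤ proj₂ r) rs → ∀ ts → 0ℚ ≤ sumRules G rs ts
    sumRules-nonNeg []             []           ts = ≤-refl
    sumRules-nonNeg ((α , w) ∷ rs) (0≤w ∷ 0≤rs) ts =
      0≤p+q (0≤p*q 0≤w (matchL-nonNeg α ts)) (sumRules-nonNeg rs 0≤rs ts)

    matchL-nonNeg : ∀ α ts → 0ℚ ≤ matchL G α ts
    matchL-nonNeg []           []            = from-yes (0ℚ ≤? 1ℚ)
    matchL-nonNeg (inj₁ V ∷ α) (t ∷ ts)      = 0≤p*q (wt-nonNeg t V) (matchL-nonNeg α ts)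
    matchL-nonNeg (inj₂ a ∷ α) (leaf b ∷ ts) with a ≟F b
    ... | yes _ = matchL-nonNeg α ts
    ... | no  _ = ≤-refl
    matchL-nonNeg (inj₂ _ ∷ _) (node _ ∷ _)  = ≤-refl
    matchL-nonNeg []           (_ ∷ _)       = ≤-refl
    matchL-nonNeg (inj₁ _ ∷ _) []            = ≤-refl
    matchL-nonNeg (inj₂ _ ∷ _) []            = ≤-refl

weightedΣfin-≤ : ∀ m K (λs f g : Fin m → ℚ) → (∀ i → 0ℚ ≤ λs i) → (∀ i → g i ≤ K * f i) →
                 Σfin m (λ i → λs i * g i) ≤ K * Σfin m (λ i → λs i * f i)
weightedΣfin-≤ zero    K λs f g 0≤λs g≤Kf = ≤-reflexive (sym (*-zeroʳ K))
weightedΣfin-≤ (suc m) K λs f g 0≤λs g≤Kf = begin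
  λs zero * g zero + Σfin m (λ i → λs (suc i) * g (suc i))
    ≤⟨ +-mono-≤ (*-monoˡ-≤-nonNeg (λs zero) {{nonNegative (0≤λs zero)}} (g≤Kf zero))
                (weightedΣfin-≤ m K (λ i → λs (suc i)) (λ i → f (suc i)) (λ i → g (suc i))
                                (λ i → 0≤λs (suc i)) (λ i → g≤Kf (suc i))) ⟩
  λs zero * (K * f zero) + K * rest
    ≡⟨ solve 4 (λ l K x r → l :* (K :* x) :+ K :* r := K :* (l :* x :+ r)) refl
               (λs zero) K (f zero) rest ⟩
  K * (λs zero * f zero + rest) ∎
  where
  open ≤-Reasoning
  rest = Σfin m (λ i → λs (suc i) * f (suc i))

positivelySpans-preserves-columnBound :
  ∀ {k} (G : PCFG k) {m F} → PositivelySpans G m F → ∀ K c c′ →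
  (∀ i → hankel G (F i) c′ ≤ K * hankel G (F i) c) →
  ∀ t → hankel G t c′ ≤ K * hankel G t c
positivelySpans-preserves-columnBound G {m} {F} spans K c c′ rowsBounded t
  with spans t
... | λs , 0≤λs , row-t =
  subst₂ (λ x y → x ≤ K * y) (sym (row-t c′)) (sym (row-t c))
    (weightedΣfin-≤ m K λs (λ i → hankel G (F i) c) (λ i → hankel G (F i) c′) 0≤λs rowsBounded)

finiteFamily-bounded : ∀ m (f : Fin m → ℕ) → ∃ λ B → ∀ i → f i ≤ℕ B
finiteFamily-bounded zero    f = 0 , λ ()
finiteFamily-bounded (suc m) f with finiteFamily-bounded m (λ i → f (suc i))
... | B , f≤B = f zero ⊔ B , λ { zero    → m≤m⊔n (f zero) B
                               ; (suc i) → ≤ℕ-trans (f≤B i) (m≤n⊔m (f zero) B) }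

2^_ : ℕ → ℚ
2^ zero  = 1ℚ
2^ suc n = 2^ n + 2^ n

2^-nonNeg : ∀ n → 0ℚ ≤ 2^ n
2^-nonNeg zero    = from-yes (0ℚ ≤? 1ℚ)
2^-nonNeg (suc n) = 0≤p+q (2^-nonNeg n) (2^-nonNeg n)

2^-≤-2^suc : ∀ n → 2^ n ≤ 2^ suc n
2^-≤-2^suc n = subst₂ _≤_ (+-identityʳ (2^ n)) refl (+-mono-≤ (≤-refl {2^ n}) (2^-nonNeg n))

2^-mono-≤ : ∀ {m n} → m ≤ℕ n → 2^ m ≤ 2^ n
2^-mono-≤ m≤n = mono′ (≤⇒≤′ m≤n)
  where
  mono′ : ∀ {m n} → m ≤′ n → 2^ m ≤ 2^ n
  mono′ ≤′-refl            = ≤-refl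
  mono′ (≤′-step {n} m≤′n) = ≤-trans (mono′ m≤′n) (2^-≤-2^suc n)

leftDepth : ∀ {k} → Skel k → ℕ
leftDepth (leaf _)       = 0
leftDepth (node [])      = 0
leftDepth (node (t ∷ _)) = suc (leftDepth t)

pattern S = zero
pattern A = suc zero
pattern B = suc (suc zero)
pattern a = zero

¼ ¾ : ℚ
¼ = + 1 / 4
¾ = + 3 / 4

rules : Fin 3 → List (RHS 3 1 × ℚ)
rules S = (inj₁ A ∷ inj₂ a ∷ [] , ½) ∷ (inj₁ B ∷ [] , ½) ∷ []
rules A = (inj₁ A ∷ [] , ¼) ∷ (inj₂ a ∷ [] , ¾) ∷ []
rules B = (inj₁ B ∷ [] , ½) ∷ (inj₂ a ∷ [] , ½) ∷ []

G : PCFG 1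
G = record
  { n        = 3
  ; start    = S
  ; rules    = rules
  ; distinct = λ { S → ((λ ()) ∷ []) ∷ [] ∷ [] ; A → ((λ ()) ∷ []) ∷ [] ∷ [] ; B → ((λ ()) ∷ []) ∷ [] ∷ [] }
  ; nonneg   = λ { S → from-yes (all? (λ r → 0ℚ ≤? proj₂ r) (rules S))
                 ; A → from-yes (all? (λ r → 0ℚ ≤? proj₂ r) (rules A))
                 ; B → from-yes (all? (λ r → 0ℚ ≤? proj₂ r) (rules B)) }
  ; le-one   = λ { S → from-yes (all? (λ r → proj₂ r ≤? 1ℚ) (rules S))
                 ; A → from-yes (all? (λ r → proj₂ r ≤? 1ℚ) (rules A))
                 ; B → from-yes (all? (λ r → proj₂ r ≤? 1ℚ) (rules B)) }
  ; sum-one  = λ { S → refl ; A → refl ; B → refl }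
  }

wA wB : Skel 1 → ℚ
wA s = wt G s A
wB s = wt G s B

½*[p*q]≡[p+p]*[¼*q] : ∀ p q → ½ * (p * q) ≡ (p + p) * (¼ * q)
½*[p*q]≡[p+p]*[¼*q] = solve 2 (λ p q → con ½ :* (p :* q) := (p :+ p) :* (con ¼ :* q)) refl

p*[½*q]≡½*[p*q] : ∀ p q → p * (½ * q) ≡ ½ * (p * q)
p*[½*q]≡½*[p*q] = solve 2 (λ p q → p :* (con ½ :* q) := con ½ :* (p :* q)) refl

wA-unary : ∀ ts → wA (node (node ts ∷ [])) ≡ ¼ * wA (node ts)
wA-unary ts = solve 1 (λ x → con ¼ :* (x :* con 1ℚ) :+ (con ¾ :* con 0ℚ :+ con 0ℚ) := con ¼ :* x)
                refl (wA (node ts))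

wB-unary : ∀ ts → wB (node (node ts ∷ [])) ≡ ½ * wB (node ts)
wB-unary ts = solve 1 (λ x → con ½ :* (x :* con 1ℚ) :+ (con ½ :* con 0ℚ :+ con 0ℚ) := con ½ :* x)
                refl (wB (node ts))

wA-nonUnary : ∀ t u us → wA (node (t ∷ u ∷ us)) ≡ 0ℚ
wA-nonUnary (leaf a)  u us = refl
wA-nonUnary (node ts) u us =
  solve 1 (λ x → con ¼ :* (x :* con 0ℚ) :+ (con ¾ :* con 0ℚ :+ con 0ℚ) := con 0ℚ) refl (wA (node ts))

wB-nonUnary : ∀ t u us → wB (node (t ∷ u ∷ us)) ≡ 0ℚ
wB-nonUnary (leaf a)  u us = refl
wB-nonUnary (node ts) u us =
  solve 1 (λ x → con ½ :* (x :* con 0ℚ) :+ (con ½ :* con 0ℚ :+ con 0ℚ) := con 0ℚ) refl (wB (node ts))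

wB≤2^leftDepth*wA : ∀ s → wB s ≤ 2^ leftDepth s * wA s
wB≤2^leftDepth*wA (leaf _)             = ≤-refl
wB≤2^leftDepth*wA (node [])            = ≤-refl
wB≤2^leftDepth*wA (node (leaf a ∷ [])) = from-yes (wB (node (leaf a ∷ [])) ≤? 2^ 1 * wA (node (leaf a ∷ [])))
wB≤2^leftDepth*wA (node (t ∷ u ∷ us))
  rewrite wA-nonUnary t u us | wB-nonUnary t u us = ≤-reflexive (sym (*-zeroʳ (2^ suc (leftDepth t))))
wB≤2^leftDepth*wA (node (node ts ∷ [])) = begin
  wB (node (node ts ∷ []))            ≡⟨ wB-unary ts ⟩
  ½ * wB (node ts)                    ≤⟨ *-monoˡ-≤-nonNeg ½ (wB≤2^leftDepth*wA (node ts)) ⟩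
  ½ * (2^ d * wA (node ts))           ≡⟨ ½*[p*q]≡[p+p]*[¼*q] (2^ d) (wA (node ts)) ⟩
  2^ suc d * (¼ * wA (node ts))       ≡⟨ cong (2^ suc d *_) (sym (wA-unary ts)) ⟩
  2^ suc d * wA (node (node ts ∷ [])) ∎
  where
  open ≤-Reasoning
  d = leftDepth (node ts)

ctxA ctxB : Ctx 1
ctxA = node [] hole (leaf a ∷ [])
ctxB = node [] hole []

hankel-ctxA : ∀ s → hankel G s ctxA ≡ ½ * wA s
hankel-ctxA s = solve 2 (λ x y → con ½ :* (x :* con 1ℚ) :+ (con ½ :* (y :* con 0ℚ) :+ con 0ℚ) := con ½ :* x)
                  refl (wA s) (wB s)

hankel-ctxB : ∀ s → hankel G s ctxB ≡ ½ * wB s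
hankel-ctxB s = solve 2 (λ x y → con ½ :* (x :* con 0ℚ) :+ (con ½ :* (y :* con 1ℚ) :+ con 0ℚ) := con ½ :* y)
                  refl (wA s) (wB s)

hankel-ctxB≤2^*hankel-ctxA : ∀ D s → leftDepth s ≤ℕ D → hankel G s ctxB ≤ 2^ D * hankel G s ctxA
hankel-ctxB≤2^*hankel-ctxA D s depth≤D = begin
  hankel G s ctxB       ≡⟨ hankel-ctxB s ⟩
  ½ * wB s              ≤⟨ *-monoˡ-≤-nonNeg ½ (≤-trans (wB≤2^leftDepth*wA s) 2^depth*wA≤2^D*wA) ⟩
  ½ * (2^ D * wA s)     ≡⟨ sym (p*[½*q]≡½*[p*q] (2^ D) (wA s)) ⟩
  2^ D * (½ * wA s)     ≡⟨ cong (2^ D *_) (sym (hankel-ctxA s)) ⟩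
  2^ D * hankel G s ctxA ∎
  where
  open ≤-Reasoning
  2^depth*wA≤2^D*wA : 2^ leftDepth s * wA s ≤ 2^ D * wA s
  2^depth*wA≤2^D*wA = *-monoʳ-≤-nonNeg (wA s) {{nonNegative (wt-nonNeg G s A)}} (2^-mono-≤ depth≤D)

spine : ℕ → Skel 1
spine zero    = node (leaf a ∷ [])
spine (suc j) = node (spine j ∷ [])

2^*wA<wB-spine : ∀ j → 2^ j * wA (spine (suc j)) < wB (spine (suc j))
2^*wA<wB-spine zero    = from-yes (2^ 0 * wA (spine 1) <? wB (spine 1))
2^*wA<wB-spine (suc j) = begin-strict
  2^ suc j * wA (spine (suc (suc j)))  ≡⟨ cong (2^ suc j *_) (wA-unary (spine j ∷ [])) ⟩
  2^ suc j * (¼ * wA (spine (suc j)))  ≡⟨ sym (½*[p*q]≡[p+p]*[¼*q] (2^ j) (wA (spine (suc j)))) ⟩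
  ½ * (2^ j * wA (spine (suc j)))      <⟨ *-monoʳ-<-pos ½ (2^*wA<wB-spine j) ⟩
  ½ * wB (spine (suc j))               ≡⟨ sym (wB-unary (spine j ∷ [])) ⟩
  wB (spine (suc (suc j)))             ∎
  where open ≤-Reasoning

2^*hankel-ctxA<hankel-ctxB-spine : ∀ j → 2^ j * hankel G (spine (suc j)) ctxA < hankel G (spine (suc j)) ctxB
2^*hankel-ctxA<hankel-ctxB-spine j = begin-strict
  2^ j * hankel G (spine (suc j)) ctxA ≡⟨ cong (2^ j *_) (hankel-ctxA (spine (suc j))) ⟩
  2^ j * (½ * wA (spine (suc j)))      ≡⟨ p*[½*q]≡½*[p*q] (2^ j) (wA (spine (suc j))) ⟩
  ½ * (2^ j * wA (spine (suc j)))      <⟨ *-monoʳ-<-pos ½ (2^*wA<wB-spine j) ⟩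
  ½ * wB (spine (suc j))               ≡⟨ sym (hankel-ctxB (spine (suc j))) ⟩
  hankel G (spine (suc j)) ctxB        ∎
  where open ≤-Reasoning

proposition4p5 : Σ ℕ λ k → Σ (PCFG k) λ G →
    ¬ (Σ ℕ λ m → Σ (Fin m → Skel k) λ F → PositivelySpans G m F)
proposition4p5 = 1 , G , λ (m , F , spans) →
  let D , depth≤D = finiteFamily-bounded m (λ i → leftDepth (F i))
      ctxB≤2^D*ctxA = positivelySpans-preserves-columnBound G spans (2^ D) ctxA ctxB
                        (λ i → hankel-ctxB≤2^*hankel-ctxA D (F i) (depth≤D i))
  in <-irrefl refl (<-≤-trans (2^*hankel-ctxA<hankel-ctxB-spine D) (ctxB≤2^D*ctxA (spine (suc D))))
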